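{- Let $G_0,G_1\in\mathbb{Z}$ and let $(G_n)_{n\ge 0}$ be defined by $G_n=G_{n-1}+G_{n-2}$ for all $n\ge 2$. For every positive integer $k$, $$\mathcal{G}_{G_0,G_1}(k)=\gcd(G_{k+1}-G_1,\;G_{k+2}-G_2).$$
   Context: For a positive integer $k$, $\mathcal{G}_{G_0,G_1}(k)$ denotes the greatest common divisor of all the integers $\sum_{i=0}^{k-1}G_{n+i}$ for $n\ge 1$, i.e., the largest integer dividing every sum of $k$ consecutive terms $G_n+G_{n+1}+\cdots+G_{n+k-1}$ with $n\ge 1$. -}

module Defs where

open import Data.Nat using (ℕ; zero; suc)
import Data.Nat as ℕ
open import Data.Integer using (ℤ; _+_; _-_; +_; _≤_)
open import Data.Integer.Divisibility using (_∣_)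
open import Data.Product using (_×_)

G : ℤ → ℤ → ℕ → ℤ
G g0 g1 zero = g0
G g0 g1 (suc zero) = g1
G g0 g1 (suc (suc n)) = G g0 g1 (suc n) + G g0 g1 n

sumBlock : ℤ → ℤ → ℕ → ℕ → ℤ
sumBlock g0 g1 n zero = + 0
sumBlock g0 g1 n (suc k) = sumBlock g0 g1 n k + G g0 g1 (n ℕ.+ k)

IsSumGCD : ℤ → ℤ → ℕ → ℤ → Set
IsSumGCD g0 g1 k d =
  (+ 0 ≤ d)
  × (∀ n → 1 ℕ.≤ n → d ∣ sumBlock g0 g1 n k)
  × (∀ c → (∀ n → 1 ℕ.≤ n → c ∣ sumBlock g0 g1 n k) → c ∣ d)

{-# OPTIONS --safe #-}
module Submission where

-- A sum of k consecutive terms telescopes, G_n + ⋯ + G_{n+k-1} = G_{n+k+1} - G_{n+1},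
-- because G_m = G_{m+2} - G_{m+1}. So the sums for n ≥ 1 are the values Δ 2, Δ 3, …
-- of Δ m = G_{m+k} - G_m, which again satisfies the Fibonacci recurrence. For such a
-- sequence any two consecutive terms generate the same divisibility ideal as the
-- whole tail, so the gcd of all the sums is gcd (Δ 2, Δ 3) = gcd (Δ 1, Δ 2).

open import Defs
open import Data.Nat using (ℕ; zero; suc)
import Data.Nat as ℕ
open import Data.Nat.Properties using (+-comm; +-identityʳ; +-suc)
open import Data.Integer using (ℤ; _-_; _+_; +_; +≤+)
open import Data.Integer.Properties using (+-inverseʳ)
open import Data.Integer.GCD using (gcd; gcd[i,j]∣i; gcd[i,j]∣j; gcd-greatest)
import Data.Integer.Divisibility as Unsigned
open import Data.Integer.Divisibility.Signed
  using (_∣_; ∣ᵤ⇒∣; ∣⇒∣ᵤ; ∣m∣n⇒∣m+n; ∣m+n∣m⇒∣n)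
open import Data.Integer.Tactic.RingSolver using (solve-∀)
open import Data.Product using (_,_)
open import Function using (_∘_)
open import Relation.Binary.PropositionalEquality using (_≡_; refl; sym; subst; cong₂; module ≡-Reasoning)

record FibonacciLike (f : ℕ → ℤ) : Set where
  constructor fibonacciLike
  field recurrence : ∀ n → f (suc (suc n)) ≡ f (suc n) + f n

open FibonacciLike

G-fibonacciLike : ∀ g0 g1 → FibonacciLike (G g0 g1)
G-fibonacciLike g0 g1 = fibonacciLike λ n → refl

shift-fibonacciLike : ∀ {f} k → FibonacciLike f → FibonacciLike (λ n → f (n ℕ.+ k))
shift-fibonacciLike k fib = fibonacciLike λ n → recurrence fib (n ℕ.+ k)

suc-fibonacciLike : ∀ {f} → FibonacciLike f → FibonacciLike (f ∘ suc)
suc-fibonacciLike fib = fibonacciLike (recurrence fib ∘ suc)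

sub-fibonacciLike : ∀ {f g} → FibonacciLike f → FibonacciLike g →
                    FibonacciLike (λ n → f n - g n)
sub-fibonacciLike {f} {g} fibf fibg = fibonacciLike λ n → begin
  f (suc (suc n)) - g (suc (suc n))       ≡⟨ cong₂ _-_ (recurrence fibf n) (recurrence fibg n) ⟩
  (f (suc n) + f n) - (g (suc n) + g n)   ≡⟨ interchange (f (suc n)) (f n) (g (suc n)) (g n) ⟩
  (f (suc n) - g (suc n)) + (f n - g n)   ∎
  where
  open ≡-Reasoning
  interchange : ∀ a b c d → (a + b) - (c + d) ≡ (a - c) + (b - d)
  interchange = solve-∀

∣-fibonacciLike : ∀ {f c} → FibonacciLike f → c ∣ f 0 → c ∣ f 1 → ∀ n → c ∣ f n
∣-fibonacciLike fib c∣f₀ c∣f₁ zero          = c∣f₀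
∣-fibonacciLike fib c∣f₀ c∣f₁ (suc zero)    = c∣f₁
∣-fibonacciLike {c = c} fib c∣f₀ c∣f₁ (suc (suc n)) =
  subst (c ∣_) (sym (recurrence fib n))
    (∣m∣n⇒∣m+n (∣-fibonacciLike fib c∣f₀ c∣f₁ (suc n)) (∣-fibonacciLike fib c∣f₀ c∣f₁ n))

∣-fibonacciLike-pred : ∀ {f c} → FibonacciLike f → ∀ n →
                       c ∣ f (suc n) → c ∣ f (suc (suc n)) → c ∣ f n
∣-fibonacciLike-pred {c = c} fib n c∣f₁ c∣f₂ =
  ∣m+n∣m⇒∣n (subst (c ∣_) (recurrence fib n) c∣f₂) c∣f₁

sumBlock-telescopes : ∀ g0 g1 n k →
                      sumBlock g0 g1 n k ≡ G g0 g1 (suc (n ℕ.+ k)) - G g0 g1 (suc n)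
sumBlock-telescopes g0 g1 n zero
  rewrite +-identityʳ n = sym (+-inverseʳ (G g0 g1 (suc n)))
sumBlock-telescopes g0 g1 n (suc k)
  rewrite sumBlock-telescopes g0 g1 n k | +-suc n k =
  step (G g0 g1 (suc (n ℕ.+ k))) (G g0 g1 (n ℕ.+ k)) (G g0 g1 (suc n))
  where
  step : ∀ a b c → (a - c) + b ≡ (a + b) - c
  step = solve-∀

theorem3p1 : (g0 g1 : ℤ) (k : ℕ) → 1 ℕ.≤ k →
    IsSumGCD g0 g1 k (gcd (G g0 g1 (k ℕ.+ 1) - G g0 g1 1) (G g0 g1 (k ℕ.+ 2) - G g0 g1 2))
theorem3p1 g0 g1 k _ rewrite +-comm k 1 | +-comm k 2 =
  +≤+ ℕ.z≤n , d∣sums , ∣d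
  where
  Δ : ℕ → ℤ
  Δ m = G g0 g1 (m ℕ.+ k) - G g0 g1 m

  Δ-fib : FibonacciLike Δ
  Δ-fib = sub-fibonacciLike (shift-fibonacciLike k (G-fibonacciLike g0 g1))
                            (G-fibonacciLike g0 g1)

  sum≡Δ : ∀ n → sumBlock g0 g1 n k ≡ Δ (suc n)
  sum≡Δ n = sumBlock-telescopes g0 g1 n k

  d : ℤ
  d = gcd (Δ 1) (Δ 2)

  d∣sums : ∀ n → 1 ℕ.≤ n → d Unsigned.∣ sumBlock g0 g1 n k
  d∣sums n _ rewrite sum≡Δ n =
    ∣⇒∣ᵤ {d} (∣-fibonacciLike (suc-fibonacciLike Δ-fib)
                               (∣ᵤ⇒∣ (gcd[i,j]∣i (Δ 1) (Δ 2)))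
                               (∣ᵤ⇒∣ (gcd[i,j]∣j (Δ 1) (Δ 2))) n)

  ∣d : ∀ c → (∀ n → 1 ℕ.≤ n → c Unsigned.∣ sumBlock g0 g1 n k) → c Unsigned.∣ d
  ∣d c c∣sums = gcd-greatest {Δ 1} {Δ 2} {c} (∣⇒∣ᵤ c∣Δ₁) (∣⇒∣ᵤ c∣Δ₂)
    where
    c∣Δ : ∀ n → c ∣ Δ (suc (suc n))
    c∣Δ n = subst (c ∣_) (sum≡Δ (suc n)) (∣ᵤ⇒∣ (c∣sums (suc n) (ℕ.s≤s ℕ.z≤n)))
    c∣Δ₂ : c ∣ Δ 2
    c∣Δ₂ = c∣Δ 0
    c∣Δ₁ : c ∣ Δ 1
    c∣Δ₁ = ∣-fibonacciLike-pred Δ-fib 1 c∣Δ₂ (c∣Δ 1)
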